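{- For all packed words $u,v$ with $v\ne\varepsilon$, the word $u\triangleleft_R v$ is irreducible if and only if $v$ is irreducible.
   Context: Words over positive integers; $|w|$ length, $\max(w)$ largest letter ($\max(\varepsilon)=0$), $w^{[k]}$ adds $k$ to every letter. Packed: every integer $1..\max(w)$ occurs. $u\odot v=u^{[\max(v)]}\cdot v$. A global descent of a packed word $w$ of length $n$ is $c$, $1\le c\le n-1$, with every letter of $w_1..w_c$ strictly greater than every letter of $w_{c+1}..w_n$; $w$ is irreducible if nonempty without global descent. For packed $w$ of length $n$, $p\ge1$, $I=\{i_1<\dots<i_p\}\subseteq\{1..n+p\}$, $\phi_I(w)$ is the word of length $n+p$ with letter $\max(w)+1$ at positions of $I$ and letters of $w$ in order elsewhere; each nonempty packed $v$ is uniquely $\phi_I(v')$. For packed $u$ and nonempty packed $v=\phi_I(v')$, $u\triangleleft_R v=\phi_{I+|u|}(u\odot v')$ with $I+|u|=\{i+|u|:i\in I\}$. -}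

module Defs where

open import Data.Nat using (ℕ; zero; suc; _+_; _≤_; _<_; _⊔_; _≡ᵇ_)
open import Data.Bool using (Bool; true; false; not)
open import Data.List using (List; []; _∷_; length; map; foldr; filter; replicate; take; drop; _++_)
open import Data.List.Membership.Propositional using (_∈_)
open import Data.Product using (∃-syntax; _×_)
open import Relation.Nullary using (¬_)
open import Relation.Binary.PropositionalEquality using (_≡_; _≢_)
open import Function using (_∘_)

-- Words over positive integers are lists of naturals (positivity is part of Packed).
Word : Set
Word = List ℕ

maxW : Word → ℕ
maxW = foldr _⊔_ 0

shiftW : ℕ → Word → Word
shiftW k = map (k +_)

Packed : Word → Set
Packed w = (∀ x → x ∈ w → 1 ≤ x) × (∀ k → 1 ≤ k → k ≤ maxW w → k ∈ w)

_⊙_ : Word → Word → Word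
u ⊙ v = shiftW (maxW v) u ++ v

GlobalDescentAt : Word → ℕ → Set
GlobalDescentAt w c =
  1 ≤ c × c < length w × (∀ x y → x ∈ take c w → y ∈ drop c w → y < x)

HasGlobalDescent : Word → Set
HasGlobalDescent w = ∃[ c ] GlobalDescentAt w c

Irreducible : Word → Set
Irreducible w = w ≢ [] × ¬ HasGlobalDescent w

-- φ_I with I given as a position mask (true = position in I):
-- inserts letter c at masked positions and letters of w in order elsewhere.
insertAt : List Bool → ℕ → Word → Word
insertAt [] c w = []
insertAt (true ∷ bs) c w = c ∷ insertAt bs c w
insertAt (false ∷ bs) c [] = []
insertAt (false ∷ bs) c (x ∷ w) = x ∷ insertAt bs c w

phi : List Bool → Word → Word
phi I w = insertAt I (suc (maxW w)) w

-- decomposition v = φ_I(v'): I = positions of max(v), v' = v with those removed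
maskOf : Word → List Bool
maskOf v = map (_≡ᵇ maxW v) v

stripMax : Word → Word
stripMax v = filter (λ x → Data.Bool.T? (not (x ≡ᵇ maxW v))) v
  where import Data.Bool

-- u ◁_R v = φ_{I+|u|}(u ⊙ v')
_◁R_ : Word → Word → Word
u ◁R v = phi (replicate (length u) false ++ maskOf v) (u ⊙ stripMax v)

{-# OPTIONS --safe #-}
module Submission where

-- Let m = max v, v' = v with the letters m deleted, P = u^[max v'] and t = max(P · v') + 1.
-- Then u ◁R v is P followed by v with every m replaced by t.  This relabelling is strictly
-- increasing on the letters of v, so it neither creates nor destroys global descents, and
-- every letter of P lies strictly between the letters of v' and t.  A cut inside P is
-- therefore never a descent (t occurs to its right), while a cut after P is a descent
-- exactly when the corresponding cut of v is one.

open import Defs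
open import Data.Bool using (true; false; not; T; T?; if_then_else_)
open import Data.Bool.Properties using (T-not-≡)
open import Data.List using (List; []; _∷_; length; map; filter; replicate; take; drop; _++_)
open import Data.List.Membership.Propositional using (_∈_)
open import Data.List.Membership.Propositional.Properties using (∈-map⁺; ∈-map⁻; ∈-++⁺ˡ; ∈-++⁺ʳ; ∈-++⁻; ∈-filter⁺)
open import Data.List.Properties using (length-map; length-++; take-map; drop-map; take++drop≡id)
open import Data.List.Relation.Binary.Subset.Propositional using (_⊆_)
open import Data.List.Relation.Unary.Any using (here; there)
open import Data.Nat using (ℕ; zero; suc; _+_; _∸_; _≤_; _<_; _≤?_; _≟_; _≡ᵇ_; s≤s; z≤n)
open import Data.Nat.Properties
open import Data.Product using (_,_)
open import Data.Sum using (_⊎_; inj₁; inj₂; [_,_]′)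
open import Data.Unit using (tt)
open import Function using (_∘_)
open import Function.Bundles using (_⇔_; mk⇔; Equivalence)
open import Function.Construct.Composition using (_⇔-∘_)
open import Relation.Binary.Definitions using (tri<; tri≈; tri>)
open import Relation.Nullary using (¬_; contradiction; yes; no)
open import Relation.Binary.PropositionalEquality using (_≡_; _≢_; refl; sym; cong; subst; module ≡-Reasoning)

private
  variable
    A : Set

take-⊆ : ∀ n (xs : List A) → take n xs ⊆ xs
take-⊆ n xs p = subst (_ ∈_) (take++drop≡id n xs) (∈-++⁺ˡ p)

drop-⊆ : ∀ n (xs : List A) → drop n xs ⊆ xs
drop-⊆ n xs p = subst (_ ∈_) (take++drop≡id n xs) (∈-++⁺ʳ (take n xs) p)

take-++-length : ∀ (xs ys : List A) n → take (length xs + n) (xs ++ ys) ≡ xs ++ take n ys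
take-++-length []       ys n = refl
take-++-length (x ∷ xs) ys n = cong (x ∷_) (take-++-length xs ys n)

drop-++-length : ∀ (xs ys : List A) n → drop (length xs + n) (xs ++ ys) ≡ drop n ys
drop-++-length []       ys n = refl
drop-++-length (x ∷ xs) ys n = drop-++-length xs ys n

drop-++-≤ : ∀ (xs ys : List A) n → n ≤ length xs → drop n (xs ++ ys) ≡ drop n xs ++ ys
drop-++-≤ xs       ys zero    _         = refl
drop-++-≤ (x ∷ xs) ys (suc n) (s≤s n≤) = drop-++-≤ xs ys n n≤

∈⇒≢[] : ∀ {x : A} {xs} → x ∈ xs → xs ≢ []
∈⇒≢[] (here _)  ()
∈⇒≢[] (there _) ()

∈⇒≤maxW : ∀ {x} (w : Word) → x ∈ w → x ≤ maxW w
∈⇒≤maxW (a ∷ w) (here refl) = m≤m⊔n a (maxW w)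
∈⇒≤maxW (a ∷ w) (there p)   = ≤-trans (∈⇒≤maxW w p) (m≤n⊔m a (maxW w))

maxW-lub : ∀ {t} (w : Word) → (∀ x → x ∈ w → x ≤ t) → maxW w ≤ t
maxW-lub []      _   = z≤n
maxW-lub (a ∷ w) w≤t = ⊔-lub (w≤t a (here refl)) (maxW-lub w (λ x → w≤t x ∘ there))

maxW-unique : ∀ {t} (w : Word) → t ∈ w → (∀ x → x ∈ w → x ≤ t) → maxW w ≡ t
maxW-unique w t∈ w≤t = ≤-antisym (maxW-lub w w≤t) (∈⇒≤maxW w t∈)

packed-maxW-∈ : ∀ {w} → Packed w → w ≢ [] → maxW w ∈ w
packed-maxW-∈ {[]}    _              w≢[] = contradiction refl w≢[]
packed-maxW-∈ {a ∷ w} (pos , onto) _    =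
  onto (maxW (a ∷ w)) (≤-trans (pos a (here refl)) (∈⇒≤maxW (a ∷ w) (here refl))) ≤-refl

Dominates : Word → Word → Set
Dominates xs ys = ∀ x y → x ∈ xs → y ∈ ys → y < x

irreducible-cong : ∀ {w w′} → w ≢ [] → w′ ≢ [] →
                   HasGlobalDescent w ⇔ HasGlobalDescent w′ → Irreducible w ⇔ Irreducible w′
irreducible-cong w≢[] w′≢[] d⇔ =
  mk⇔ (λ (_ , ¬d) → w′≢[] , ¬d ∘ Equivalence.from d⇔)
      (λ (_ , ¬d) → w≢[] , ¬d ∘ Equivalence.to d⇔)

module StrictlyIncreasing (f : ℕ → ℕ) (v : Word)
  (f-< : ∀ {x y} → x ∈ v → y ∈ v → y < x → f y < f x) where

  f-<⁻ : ∀ {x y} → x ∈ v → y ∈ v → f y < f x → y < x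
  f-<⁻ {x} {y} x∈ y∈ fy<fx with <-cmp x y
  ... | tri< x<y _ _ = contradiction fy<fx (<⇒≯ (f-< y∈ x∈ x<y))
  ... | tri≈ _ refl _ = contradiction fy<fx (<-irrefl refl)
  ... | tri> _ _ y<x = y<x

  dominates-map⁺ : ∀ {xs ys} → xs ⊆ v → ys ⊆ v → Dominates xs ys → Dominates (map f xs) (map f ys)
  dominates-map⁺ xs⊆v ys⊆v D _ _ fx∈ fy∈ with ∈-map⁻ f fx∈ | ∈-map⁻ f fy∈
  ... | x , x∈ , refl | y , y∈ , refl = f-< (xs⊆v x∈) (ys⊆v y∈) (D x y x∈ y∈)

  dominates-map⁻ : ∀ {xs ys} → xs ⊆ v → ys ⊆ v → Dominates (map f xs) (map f ys) → Dominates xs ys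
  dominates-map⁻ xs⊆v ys⊆v D x y x∈ y∈ =
    f-<⁻ (xs⊆v x∈) (ys⊆v y∈) (D (f x) (f y) (∈-map⁺ f x∈) (∈-map⁺ f y∈))

  globalDescentAt-map : ∀ c → GlobalDescentAt (map f v) c ⇔ GlobalDescentAt v c
  globalDescentAt-map c rewrite length-map f v | take-map {f = f} c v | drop-map {f = f} c v =
    mk⇔ (λ (1≤c , c< , D) → 1≤c , c< , dominates-map⁻ (take-⊆ c v) (drop-⊆ c v) D)
        (λ (1≤c , c< , D) → 1≤c , c< , dominates-map⁺ (take-⊆ c v) (drop-⊆ c v) D)

  hasGlobalDescent-map : HasGlobalDescent (map f v) ⇔ HasGlobalDescent v
  hasGlobalDescent-map =
    mk⇔ (λ (c , d) → c , Equivalence.to (globalDescentAt-map c) d)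
        (λ (c , d) → c , Equivalence.from (globalDescentAt-map c) d)

descent-below-maxW : ∀ (w : Word) c y → 1 ≤ c → Dominates (take c w) (drop c w) →
                     y ∈ drop c w → y < maxW w
descent-below-maxW (a ∷ w) (suc c) y _ D y∈ = <-≤-trans (D a y (here refl) y∈) (m≤m⊔n a (maxW w))

no-descent-inside : ∀ {t} (P w : Word) d → t ∈ w → (∀ p → p ∈ P → p < t) →
                    1 ≤ d → d ≤ length P → ¬ GlobalDescentAt (P ++ w) d
no-descent-inside {t} (p ∷ P) w (suc d) t∈w P<t _ (s≤s d≤) (_ , _ , D) =
  <-asym (P<t p (here refl)) (D p t (here refl) t∈drop)
  where
  t∈drop : t ∈ drop d (P ++ w)
  t∈drop rewrite drop-++-≤ P w d d≤ = ∈-++⁺ʳ (drop d P) t∈w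

module Prefix (P w : Word) (max∈w : maxW w ∈ w)
  (P<max : ∀ p → p ∈ P → p < maxW w)
  (rest<P : ∀ p y → p ∈ P → y ∈ w → y < maxW w → y < p) where

  globalDescentAt-shift : ∀ c → 1 ≤ c → GlobalDescentAt (P ++ w) (length P + c) ⇔ GlobalDescentAt w c
  globalDescentAt-shift c 1≤c
    rewrite length-++ P {w} | take-++-length P w c | drop-++-length P w c =
    mk⇔ (λ (_ , c< , D) → 1≤c , +-cancelˡ-< (length P) c (length w) c< ,
                          λ x y x∈ → D x y (∈-++⁺ʳ P x∈))
        (λ (_ , c< , D) → ≤-trans 1≤c (m≤n+m c (length P)) , +-monoʳ-< (length P) c< ,
                          extend D)
    where
    extend : Dominates (take c w) (drop c w) → Dominates (P ++ take c w) (drop c w)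
    extend D x y x∈ y∈ with ∈-++⁻ P x∈
    ... | inj₁ x∈P = rest<P x y x∈P (drop-⊆ c w y∈) (descent-below-maxW w c y 1≤c D y∈)
    ... | inj₂ x∈t = D x y x∈t y∈

  hasGlobalDescent-++ : HasGlobalDescent (P ++ w) ⇔ HasGlobalDescent w
  hasGlobalDescent-++ = mk⇔ to from
    where
    to : HasGlobalDescent (P ++ w) → HasGlobalDescent w
    to (d , gd@(1≤d , _)) with d ≤? length P
    ... | yes d≤ = contradiction gd (no-descent-inside P w d max∈w P<max 1≤d d≤)
    ... | no d≰ = d ∸ length P , Equivalence.to (globalDescentAt-shift _ (m<n⇒0<n∸m P<d))
                    (subst (GlobalDescentAt (P ++ w)) (sym (m+[n∸m]≡n (<⇒≤ P<d))) gd)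
      where P<d = ≰⇒> d≰
    from : HasGlobalDescent w → HasGlobalDescent (P ++ w)
    from (c , gd@(1≤c , _)) = length P + c , Equivalence.from (globalDescentAt-shift c 1≤c) gd

≡ᵇ-refl : ∀ m → (m ≡ᵇ m) ≡ true
≡ᵇ-refl zero    = refl
≡ᵇ-refl (suc m) = ≡ᵇ-refl m

≢⇒≡ᵇ≡false : ∀ {x m} → x ≢ m → (x ≡ᵇ m) ≡ false
≢⇒≡ᵇ≡false {x} {m} x≢m with x ≡ᵇ m in eq
... | true  = contradiction (≡ᵇ⇒≡ x m (subst T (sym eq) tt)) x≢m
... | false = refl

stripMax-∈ : ∀ {x} (v : Word) → x ∈ v → x ≢ maxW v → x ∈ stripMax v
stripMax-∈ v x∈ x≢max =
  ∈-filter⁺ (λ y → T? (not (y ≡ᵇ maxW v))) x∈ (Equivalence.from T-not-≡ (≢⇒≡ᵇ≡false x≢max))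

relabel : ℕ → ℕ → ℕ → ℕ
relabel m c x = if x ≡ᵇ m then c else x

relabel-self : ∀ m c → relabel m c m ≡ c
relabel-self m c rewrite ≡ᵇ-refl m = refl

relabel-≢ : ∀ {m c x} → x ≢ m → relabel m c x ≡ x
relabel-≢ x≢m rewrite ≢⇒≡ᵇ≡false x≢m = refl

insertAt-falses-++ : ∀ (xs : Word) bs c ys →
                     insertAt (replicate (length xs) false ++ bs) c (xs ++ ys) ≡ xs ++ insertAt bs c ys
insertAt-falses-++ []       bs c ys = refl
insertAt-falses-++ (x ∷ xs) bs c ys = cong (x ∷_) (insertAt-falses-++ xs bs c ys)

insertAt-mask : ∀ m c (v : Word) →
  insertAt (map (_≡ᵇ m) v) c (filter (λ x → T? (not (x ≡ᵇ m))) v) ≡ map (relabel m c) v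
insertAt-mask m c []      = refl
insertAt-mask m c (x ∷ v) with x ≡ᵇ m
... | true  = cong (c ∷_) (insertAt-mask m c v)
... | false = cong (x ∷_) (insertAt-mask m c v)

module RightAction (u v : Word) (u-pos : ∀ x → x ∈ u → 1 ≤ x) (max∈v : maxW v ∈ v) where

  v′ : Word
  v′ = stripMax v

  P : Word
  P = shiftW (maxW v′) u

  top : ℕ
  top = suc (maxW (P ++ v′))

  relabelMax : ℕ → ℕ
  relabelMax = relabel (maxW v) top

  ◁R≡ : u ◁R v ≡ P ++ map relabelMax v
  ◁R≡ = begin
    insertAt (replicate (length u) false ++ maskOf v) top (P ++ v′)
      ≡⟨ cong (λ n → insertAt (replicate n false ++ maskOf v) top (P ++ v′))
              (sym (length-map (maxW v′ +_) u)) ⟩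
    insertAt (replicate (length P) false ++ maskOf v) top (P ++ v′)
      ≡⟨ insertAt-falses-++ P (maskOf v) top v′ ⟩
    P ++ insertAt (maskOf v) top v′
      ≡⟨ cong (P ++_) (insertAt-mask (maxW v) top v) ⟩
    P ++ map relabelMax v ∎
    where open ≡-Reasoning

  P<top : ∀ p → p ∈ P → p < top
  P<top p p∈ = s≤s (∈⇒≤maxW (P ++ v′) (∈-++⁺ˡ p∈))

  v′<top : ∀ y → y ∈ v′ → y < top
  v′<top y y∈ = s≤s (∈⇒≤maxW (P ++ v′) (∈-++⁺ʳ P y∈))

  v′<P : ∀ p y → p ∈ P → y ∈ v′ → y < p
  v′<P p y p∈ y∈ with ∈-map⁻ (maxW v′ +_) p∈
  ... | a , a∈ , refl = ≤-<-trans (∈⇒≤maxW v′ y∈) (m<m+n (maxW v′) (u-pos a a∈))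

  relabelMax-increasing : ∀ {x y} → x ∈ v → y ∈ v → y < x → relabelMax y < relabelMax x
  relabelMax-increasing {x} {y} x∈ y∈ y<x with x ≟ maxW v | <⇒≢ (<-≤-trans y<x (∈⇒≤maxW v x∈))
  ... | yes refl | y≢max rewrite relabel-self (maxW v) top | relabel-≢ {c = top} y≢max =
    v′<top y (stripMax-∈ v y∈ y≢max)
  ... | no x≢max | y≢max rewrite relabel-≢ {c = top} x≢max | relabel-≢ {c = top} y≢max = y<x

  relabelled-∈ : ∀ {y} → y ∈ map relabelMax v → y ≡ top ⊎ y ∈ v′
  relabelled-∈ y∈ with ∈-map⁻ relabelMax y∈
  ... | x , x∈ , refl with x ≟ maxW v
  ...   | yes refl = inj₁ (relabel-self (maxW v) top)
  ...   | no x≢max = inj₂ (subst (_∈ v′) (sym (relabel-≢ x≢max)) (stripMax-∈ v x∈ x≢max))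

  top∈ : top ∈ map relabelMax v
  top∈ = subst (_∈ map relabelMax v) (relabel-self (maxW v) top) (∈-map⁺ relabelMax max∈v)

  maxW-relabelled : maxW (map relabelMax v) ≡ top
  maxW-relabelled = maxW-unique (map relabelMax v) top∈
    (λ y y∈ → [ ≤-reflexive , <⇒≤ ∘ v′<top y ]′ (relabelled-∈ y∈))

  hasGlobalDescent-◁R : HasGlobalDescent (P ++ map relabelMax v) ⇔ HasGlobalDescent v
  hasGlobalDescent-◁R =
    StrictlyIncreasing.hasGlobalDescent-map relabelMax v relabelMax-increasing
      ⇔-∘ Prefix.hasGlobalDescent-++ P (map relabelMax v) max∈ P<max rest<P
    where
    max∈ : maxW (map relabelMax v) ∈ map relabelMax v
    max∈ rewrite maxW-relabelled = top∈
    P<max : ∀ p → p ∈ P → p < maxW (map relabelMax v)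
    P<max rewrite maxW-relabelled = P<top
    rest<P : ∀ p y → p ∈ P → y ∈ map relabelMax v → y < maxW (map relabelMax v) → y < p
    rest<P p y p∈ y∈ rewrite maxW-relabelled with relabelled-∈ y∈
    ... | inj₁ refl  = λ top<top → contradiction top<top (<-irrefl refl)
    ... | inj₂ y∈v′ = λ _ → v′<P p y p∈ y∈v′

mainTheorem18 : (u v : Word) → Packed u → Packed v → v ≢ [] →
                Irreducible (u ◁R v) ⇔ Irreducible v
mainTheorem18 u v (u-pos , _) pv v≢[] =
  subst (λ w → Irreducible w ⇔ Irreducible v) (sym ◁R≡)
    (irreducible-cong (∈⇒≢[] (∈-++⁺ʳ P top∈)) v≢[] hasGlobalDescent-◁R)
  where open RightAction u v u-pos (packed-maxW-∈ pv v≢[])
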